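{- For every integer $k>1$, the generalised ant with rule word $L^{2k}R$ has at least $k-1$ pairwise distinct harmonic highways, i.e. highways of period $32k+4$ and drift $(\pm2,\pm2)$.
   Context: A generalised ant with rule word $w=w_0w_1\cdots w_{|w|-1}\in\{L,R\}^+$ has state set $Q=\{\rightarrow,\uparrow,\leftarrow,\downarrow\}$ (the four unit vectors of $\mathbb{Z}^2$) and alphabet $A=\{0,1,\dots,|w|-1\}=\mathbb{Z}/|w|\mathbb{Z}$. A configuration is $(C,(i,j),d)\in A^{\mathbb{Z}^2}\times\mathbb{Z}^2\times Q$ (picture, ant position, ant direction). The transition $T_w(C,(i,j),d)=(C',(i',j'),d')$ is: $C'(i,j)=C(i,j)+1 \bmod |w|$ and $C'(k,l)=C(k,l)$ for $(k,l)\neq(i,j)$; $d'$ is $d$ rotated by $90^\circ$ clockwise if $w_{C(i,j)}=R$ and counterclockwise if $w_{C(i,j)}=L$; $(i',j')=(i,j)+d'$. A pattern is a map $P:S\to A$ with $S\subseteq\mathbb{Z}^2$ finite (its support); $T_w$ is applied to $(P,(i,j),d)$ by the same rule, provided $(i,j)\in S$. A highway of period $N$ and drift $(a,b)\in\mathbb{Z}^2$ of the ant $w$ is given by a pattern $P$ with support $S$, a position $(i,j)\in S$ and a direction $d$ such that $T_w$ can be applied $N$ times starting from $(P,(i,j),d)$ (the ant stays in $S$ before each application), the resulting pattern $T_w^N(P)$ has the ant at position $(i,j)+(a,b)$ with direction $d$, and for all $(x,y)\in S$: $P(x,y)=T_w^N(P)(x+a,y+b)$ if $(x+a,y+b)\in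 S$, and $P(x,y)=0$ otherwise. The trace of the ant is the sequence of symbols it reads along its evolution; a highway yields a periodic trace. Highways obtained from one another by rotation, translation, or by choosing another pattern along the same periodic evolution are regarded as the same highway; highways are distinct if their periodic traces differ (e.g. one contains a factor that the other does not). -}

module Defs where

open import Data.Nat as ℕ using (ℕ; zero; suc; _<_)
open import Data.Nat.DivMod using (_mod_)
open import Data.Integer as ℤ using (ℤ)
open import Data.Fin using (Fin; toℕ)
open import Data.Vec using (Vec; lookup; replicate; _∷ʳ_)
open import Data.List using (List; []; _∷_; _++_; take; drop)
open import Data.List.Membership.Propositional using (_∈_; _∉_)
open import Data.Sum using (_⊎_)
open import Data.Product using (Σ; _×_; _,_; proj₁; proj₂)
open import Data.Product.Properties using (≡-dec)
open import Relation.Nullary using (¬_; yes; no)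
open import Relation.Binary.PropositionalEquality using (_≡_)

data Turn : Set where
  L R : Turn

data Dir : Set where
  east north west south : Dir

Pos : Set
Pos = ℤ × ℤ

_⊕_ : Pos → Pos → Pos
(a , b) ⊕ (c , d) = (a ℤ.+ c , b ℤ.+ d)

_≟ᴾ_ : (p q : Pos) → Relation.Nullary.Dec (p ≡ q)
_≟ᴾ_ = ≡-dec ℤ._≟_ ℤ._≟_

vec : Dir → Pos
vec east  = (ℤ.+ 1 , ℤ.+ 0)
vec north = (ℤ.+ 0 , ℤ.+ 1)
vec west  = (ℤ.- (ℤ.+ 1) , ℤ.+ 0)
vec south = (ℤ.+ 0 , ℤ.- (ℤ.+ 1))

cw : Dir → Dir
cw east  = south
cw south = west
cw west  = north
cw north = east

ccw : Dir → Dir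
ccw east  = north
ccw north = west
ccw west  = south
ccw south = east

turn : Turn → Dir → Dir
turn R = cw
turn L = ccw

module Ant {m : ℕ} (w : Vec Turn (suc m)) where

  Sym : Set
  Sym = Fin (suc m)

  inc : Sym → Sym
  inc i = suc (toℕ i) mod (suc m)

  -- A configuration: picture (only its values on the support matter),
  -- ant position and ant direction.
  record Config : Set where
    constructor config
    field
      pic : Pos → Sym
      pos : Pos
      dir : Dir
  open Config public

  update : (Pos → Sym) → Pos → Sym → Pos → Sym
  update C p a q with q ≟ᴾ p
  ... | yes _ = a
  ... | no  _ = C q

  step : Config → Config
  step (config C p d) =
    let d' = turn (lookup w (C p)) d
    in config (update C p (inc (C p))) (p ⊕ vec d') d'

  iter : ℕ → Config → Config
  iter zero    c = c
  iter (suc t) c = iter t (step c)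

  trace : ℕ → Config → List Sym
  trace zero    c = []
  trace (suc t) c = pic c (pos c) ∷ trace t (step c)

  record IsHighway (N : ℕ) (δ : Pos) (S : List Pos) (P : Pos → Sym)
                   (p : Pos) (d : Dir) : Set where
    field
      start∈S   : p ∈ S
      staysIn   : ∀ t → t < N → pos (iter t (config P p d)) ∈ S
      endPos    : pos (iter N (config P p d)) ≡ p ⊕ δ
      endDir    : dir (iter N (config P p d)) ≡ d
      shiftIn   : ∀ x → x ∈ S → (x ⊕ δ) ∈ S →
                  P x ≡ pic (iter N (config P p d)) (x ⊕ δ)
      shiftOut  : ∀ x → x ∈ S → (x ⊕ δ) ∉ S → P x ≡ Data.Fin.zero

  record Highway (N : ℕ) (δ : Pos) : Set where
    field
      support : List Pos
      values  : Pos → Sym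
      start   : Pos
      heading : Dir
      isHighway : IsHighway N δ support values start heading

  htrace : ∀ {N δ} → Highway N δ → List Sym
  htrace {N} h = trace N (config (Highway.values h) (Highway.start h) (Highway.heading h))

CyclicConj : {A : Set} → List A → List A → Set
CyclicConj u v = Σ ℕ λ r → drop r u ++ take r u ≡ v

antWord : (k : ℕ) → Vec Turn (suc (2 ℕ.* k))
antWord k = replicate (2 ℕ.* k) L ∷ʳ R

HarmonicDrift : Pos → Set
HarmonicDrift (a , b) = (a ≡ ℤ.+ 2 ⊎ a ≡ ℤ.- (ℤ.+ 2)) × (b ≡ ℤ.+ 2 ⊎ b ≡ ℤ.- (ℤ.+ 2))

HarmonicHighway : ℕ → Set
HarmonicHighway k =
  Σ Pos λ δ → HarmonicDrift δ × Ant.Highway (antWord k) (32 ℕ.* k ℕ.+ 4) δ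

hhTrace : (k : ℕ) → HarmonicHighway k → List (Fin (suc (2 ℕ.* k)))
hhTrace k (δ , _ , h) = Ant.htrace (antWord k) h

Distinct : (k : ℕ) → HarmonicHighway k → HarmonicHighway k → Set
Distinct k h h' = ¬ CyclicConj (hhTrace k h) (hhTrace k h')

{-# OPTIONS --safe #-}
module Submission where

-- Let K = 2k and (i + 1) + (m + 1) = K.  Started at the origin, facing east, on a pattern whose
-- only non-zero cells are (-1,-1) ↦ i+2, (0,-1) ↦ i+1, (-1,-2) ↦ i and (0,-2) ↦ i+1, the ant runs
-- K laps around one unit square, m + 1 laps around a second and m laps around a third, with a few
-- single steps in between and at the end; after 4K + 8m + 10 steps it stands at (1,1), facing
-- east, on the same pattern with i and m exchanged.  Two such half periods make a highway of
-- period 32k + 4 and drift (2,2).  Its trace contains K followed by i + 1 (right after the first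
-- laps), whereas in the trace for any larger i, read cyclically, K is only ever followed by 0, K
-- or a value exceeding i + 1.  Hence i = 0, …, k − 2 give k − 1 highways whose traces are not
-- rotations of one another.

open import Defs
open import Data.Nat using (ℕ; _<_; _∸_)
open import Data.Fin using (Fin)
open import Data.Vec using (Vec; lookup)
open import Relation.Binary.PropositionalEquality using (_≢_)
open import Data.Product using (Σ; _×_)

open import Agda.Builtin.FromNat using (Number; fromNat)
open import Agda.Builtin.FromNeg using (Negative)
open import Data.Fin as Fin using (toℕ)
import Data.Fin.Properties as Fin
open import Data.Integer as ℤ using (ℤ)
open import Data.Integer.Literals using () renaming (number to ℤ-number; negative to ℤ-negative)
import Data.Integer.Properties as ℤ
open import Algebra.Properties.AbelianGroup ℤ.+-0-abelianGroup using (∙-cancelˡ)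
open import Data.List using (List; []; _∷_; _++_; take; drop; map)
open import Data.List.Properties using (++-assoc; ++-identityʳ; take++drop≡id; take-map; drop-map; map-++)
open import Data.List.Membership.Propositional using (_∈_; _∉_)
open import Data.List.Membership.Propositional.Properties using (∈-map⁺; ∈-++⁺ˡ; ∈-++⁺ʳ)
open import Data.List.Membership.DecPropositional _≟ᴾ_ using (_∈?_)
open import Data.List.Relation.Unary.All as All using (All; []; _∷_; all?)
open import Data.List.Relation.Unary.All.Properties using (All¬⇒¬Any)
open import Data.List.Relation.Unary.AllPairs using (_∷_)
open import Data.List.Relation.Unary.Any as Any using (here; there)
open import Data.List.Relation.Unary.Unique.DecPropositional _≟ᴾ_ using (unique?)
open import Data.Nat as ℕ using (zero; suc; _+_; _*_; _≤_)
open import Data.Nat.DivMod using (_%_; m<n⇒m%n≡m; n%n≡0)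
import Data.Nat.Literals as ℕ
import Data.Nat.Properties as ℕ
open import Data.Nat.Tactic.RingSolver using (solve-∀)
open import Data.Product using (∃₂; _,_; proj₁; proj₂)
open import Data.Sum using (_⊎_; inj₁; [_,_]′)
open import Data.Unit using (⊤; tt)
open import Data.Vec using (replicate; _∷ʳ_; tabulate)
open import Data.Vec.Properties using (lookup∘tabulate)
open import Function using (_∘_; id; flip)
open import Relation.Binary.Definitions using (tri<; tri≈; tri>)
open import Relation.Binary.PropositionalEquality
  using (_≡_; refl; sym; trans; cong; cong₂; subst; subst₂; module ≡-Reasoning)
open import Relation.Nullary using (¬_; Dec; yes; no; contradiction)
open import Relation.Nullary.Decidable using (True; toWitness; fromWitness; from-yes; _→-dec_; _⊎-dec_)

instance
  ℕ-literals : Number ℕ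
  ℕ-literals = ℕ.number
  ℤ-literals : Number ℤ
  ℤ-literals = ℤ-number
  ℤ-negative-literals : Negative ℤ
  ℤ-negative-literals = ℤ-negative
  ⊤-instance : ⊤
  ⊤-instance = tt

⊕-identityˡ : ∀ x → (0 , 0) ⊕ x ≡ x
⊕-identityˡ (a , b) = cong₂ _,_ (ℤ.+-identityˡ a) (ℤ.+-identityˡ b)

⊕-assoc : ∀ x y z → (x ⊕ y) ⊕ z ≡ x ⊕ (y ⊕ z)
⊕-assoc (a , b) (c , d) (e , f) = cong₂ _,_ (ℤ.+-assoc a c e) (ℤ.+-assoc b d f)

⊕-comm : ∀ x y → x ⊕ y ≡ y ⊕ x
⊕-comm (a , b) (c , d) = cong₂ _,_ (ℤ.+-comm a c) (ℤ.+-comm b d)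

⊕-cancelˡ : ∀ o {x y} → o ⊕ x ≡ o ⊕ y → x ≡ y
⊕-cancelˡ (a , b) {c , d} {e , f} eq =
  cong₂ _,_ (∙-cancelˡ a c e (cong proj₁ eq)) (∙-cancelˡ b d f (cong proj₂ eq))

ccw⁴ : ∀ d → ccw (ccw (ccw (ccw d))) ≡ d
ccw⁴ east  = refl
ccw⁴ north = refl
ccw⁴ west  = refl
ccw⁴ south = refl

module Square (p₀ : Pos) (d₀ : Dir) where

  p₁ p₂ p₃ : Pos
  p₁ = p₀ ⊕ vec (ccw d₀)
  p₂ = p₁ ⊕ vec (ccw (ccw d₀))
  p₃ = p₂ ⊕ vec (ccw (ccw (ccw d₀)))

  cells : List Pos
  cells = p₃ ∷ p₂ ∷ p₁ ∷ p₀ ∷ []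

halfCells : List Pos
halfCells = (0 , 0) ∷ (0 , 1) ∷ (-1 , 1) ∷ (-1 , 0) ∷ (0 , -1) ∷ (1 , -1) ∷ (1 , 0) ∷
            (-1 , -1) ∷ (-1 , -2) ∷ (0 , -2) ∷ []

lookup-replicate∷ʳ-< : ∀ {A : Set} n (x y : A) (i : Fin (suc n)) → toℕ i < n →
                       lookup (replicate n x ∷ʳ y) i ≡ x
lookup-replicate∷ʳ-< (suc n) x y Fin.zero    _           = refl
lookup-replicate∷ʳ-< (suc n) x y (Fin.suc i) (ℕ.s≤s i<n) = lookup-replicate∷ʳ-< n x y i i<n

lookup-replicate∷ʳ-≡ : ∀ {A : Set} n (x y : A) (i : Fin (suc n)) → toℕ i ≡ n →
                       lookup (replicate n x ∷ʳ y) i ≡ y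
lookup-replicate∷ʳ-≡ zero    x y Fin.zero    _   = refl
lookup-replicate∷ʳ-≡ (suc n) x y (Fin.suc i) i≡n =
  lookup-replicate∷ʳ-≡ n x y i (ℕ.suc-injective i≡n)

module _ {m : ℕ} (w : Vec Turn (suc m)) where
  open Ant w using (Sym; inc)

  toℕ-inc-< : (i : Sym) → toℕ i < m → toℕ (inc i) ≡ suc (toℕ i)
  toℕ-inc-< i i<m = trans (Fin.toℕ-fromℕ< _) (m<n⇒m%n≡m (ℕ.s≤s i<m))

  toℕ-inc-≡ : (i : Sym) → toℕ i ≡ m → toℕ (inc i) ≡ 0
  toℕ-inc-≡ i i≡m =
    trans (Fin.toℕ-fromℕ< _) (subst (λ j → suc j % suc m ≡ 0) (sym i≡m) (n%n≡0 (suc m)))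

-- Factors and cyclic rotations

infix 4 _IsFactorOf_
_IsFactorOf_ : {A : Set} → List A → List A → Set
xs IsFactorOf ys = ∃₂ λ as bs → ys ≡ as ++ xs ++ bs

module _ {A : Set} where

  factor-trans : {xs ys zs : List A} → xs IsFactorOf ys → ys IsFactorOf zs → xs IsFactorOf zs
  factor-trans {xs} (as , bs , refl) (cs , ds , refl) = cs ++ as , bs ++ ds , (begin
    cs ++ (as ++ xs ++ bs) ++ ds  ≡⟨ cong (cs ++_) (++-assoc as (xs ++ bs) ds) ⟩
    cs ++ as ++ (xs ++ bs) ++ ds  ≡⟨ cong (λ l → cs ++ as ++ l) (++-assoc xs bs ds) ⟩
    cs ++ as ++ xs ++ bs ++ ds    ≡⟨ ++-assoc cs as (xs ++ bs ++ ds) ⟨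
    (cs ++ as) ++ xs ++ bs ++ ds  ∎)
    where open ≡-Reasoning

  factor-of-doubled-rotation : (ts ds : List A) → ts ++ ds IsFactorOf (ds ++ ts) ++ (ds ++ ts)
  factor-of-doubled-rotation ts ds = ds , ts , (begin
    (ds ++ ts) ++ ds ++ ts  ≡⟨ ++-assoc ds ts (ds ++ ts) ⟩
    ds ++ ts ++ ds ++ ts    ≡⟨ cong (ds ++_) (++-assoc ts ds ts) ⟨
    ds ++ (ts ++ ds) ++ ts  ∎)
    where open ≡-Reasoning

  CyclicConj⇒factors : {xs ys : List A} → CyclicConj xs ys →
                       xs IsFactorOf ys ++ ys × ys IsFactorOf xs ++ xs
  CyclicConj⇒factors {xs} (r , refl) =
    subst (λ l → l IsFactorOf rotated ++ rotated) (take++drop≡id r xs)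
      (factor-of-doubled-rotation (take r xs) (drop r xs)) ,
    subst (λ l → rotated IsFactorOf l ++ l) (take++drop≡id r xs)
      (factor-of-doubled-rotation (drop r xs) (take r xs))
    where
    rotated : List A
    rotated = drop r xs ++ take r xs

CyclicConj-map : {A B : Set} (f : A → B) {xs ys : List A} →
                 CyclicConj xs ys → CyclicConj (map f xs) (map f ys)
CyclicConj-map f {xs} (r , refl) = r , (begin
  drop r (map f xs) ++ take r (map f xs)  ≡⟨ cong₂ _++_ (drop-map r xs) (take-map r xs) ⟩
  map f (drop r xs) ++ map f (take r xs)  ≡⟨ map-++ f (drop r xs) (take r xs) ⟨
  map f (drop r xs ++ take r xs)          ∎)
  where open ≡-Reasoning

-- Pictures with values in ℕ

infixl 6 _[_≔_]
_[_≔_] : (Pos → ℕ) → Pos → ℕ → Pos → ℕ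
(F [ p ≔ v ]) x with x ≟ᴾ p
... | yes _ = v
... | no  _ = F x

[≔]-same : ∀ F p v → (F [ p ≔ v ]) p ≡ v
[≔]-same F p v with p ≟ᴾ p
... | yes _   = refl
... | no  p≢p = contradiction refl p≢p

[≔]-other : ∀ F {p} v {x} → x ≢ p → (F [ p ≔ v ]) x ≡ F x
[≔]-other F {p} v {x} x≢p with x ≟ᴾ p
... | yes x≡p = contradiction x≡p x≢p
... | no  _   = refl

raise : List Pos → ℕ → (Pos → ℕ) → Pos → ℕ
raise S n F x with x ∈? S
... | yes _ = F x + n
... | no  _ = F x

raise-∈ : ∀ {S} n F {x} → x ∈ S → raise S n F x ≡ F x + n
raise-∈ {S} n F {x} x∈S with x ∈? S
... | yes _   = refl
... | no  x∉S = contradiction x∈S x∉S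

raise-∉ : ∀ {S} n F {x} → x ∉ S → raise S n F x ≡ F x
raise-∉ {S} n F {x} x∉S with x ∈? S
... | yes x∈S = contradiction x∈S x∉S
... | no  _   = refl

raise-zero : ∀ {S} F x → raise S 0 F x ≡ F x
raise-zero {S} F x with x ∈? S
... | yes _ = ℕ.+-identityʳ (F x)
... | no  _ = refl

raise-+ : ∀ {S} m n F x → raise S m (raise S n F) x ≡ raise S (n + m) F x
raise-+ {S} m n F x with x ∈? S
... | yes x∈S = trans (cong (_+ m) (raise-∈ n F x∈S)) (ℕ.+-assoc (F x) n m)
... | no  x∉S = raise-∉ n F x∉S

raise-∷ : ∀ {S} F {p} → p ∉ S →
          ∀ x → (raise S 1 F [ p ≔ suc (raise S 1 F p) ]) x ≡ raise (p ∷ S) 1 F x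
raise-∷ {S} F {p} p∉S x = by-cases (x ≟ᴾ p) (x ∈? S)
  where
  open ≡-Reasoning
  by-cases : Dec (x ≡ p) → Dec (x ∈ S) →
             (raise S 1 F [ p ≔ suc (raise S 1 F p) ]) x ≡ raise (p ∷ S) 1 F x
  by-cases (yes refl) _ = begin
    (raise S 1 F [ x ≔ suc (raise S 1 F x) ]) x  ≡⟨ [≔]-same (raise S 1 F) x _ ⟩
    suc (raise S 1 F x)                          ≡⟨ cong suc (raise-∉ 1 F p∉S) ⟩
    suc (F x)                                    ≡⟨ ℕ.+-comm 1 (F x) ⟩
    F x + 1                                      ≡⟨ raise-∈ {S = x ∷ S} 1 F (here refl) ⟨
    raise (x ∷ S) 1 F x                          ∎
  by-cases (no x≢p) (yes x∈S) = begin
    (raise S 1 F [ p ≔ _ ]) x  ≡⟨ [≔]-other (raise S 1 F) _ x≢p ⟩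
    raise S 1 F x              ≡⟨ raise-∈ 1 F x∈S ⟩
    F x + 1                    ≡⟨ raise-∈ {S = p ∷ S} 1 F (there x∈S) ⟨
    raise (p ∷ S) 1 F x        ∎
  by-cases (no x≢p) (no x∉S) = begin
    (raise S 1 F [ p ≔ _ ]) x  ≡⟨ [≔]-other (raise S 1 F) _ x≢p ⟩
    raise S 1 F x              ≡⟨ raise-∉ 1 F x∉S ⟩
    F x                        ≡⟨ raise-∉ {S = p ∷ S} 1 F ([ x≢p , x∉S ]′ ∘ Any.toSum) ⟨
    raise (p ∷ S) 1 F x        ∎

infixl 5 _◃_
_◃_ : (Pos → ℕ) → List (Pos × ℕ) → Pos → ℕ
F ◃ []             = F
F ◃ ((p , v) ∷ as) = (F ◃ as) [ p ≔ v ]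

◃-self : ∀ F as → All (λ (p , v) → F p ≡ v) as → ∀ x → (F ◃ as) x ≡ F x
◃-self F []             []            x = refl
◃-self F ((p , v) ∷ as) (Fp≡v ∷ rest) x with x ≟ᴾ p
... | yes refl = sym Fp≡v
... | no  _    = ◃-self F as rest x

◃-preserves : ∀ (P : ℕ → Set) F as → (∀ x → P (F x)) → All (P ∘ proj₂) as →
              ∀ x → P ((F ◃ as) x)
◃-preserves P F []             PF []          x = PF x
◃-preserves P F ((p , v) ∷ as) PF (Pv ∷ rest) x with x ≟ᴾ p
... | yes _ = Pv
... | no  _ = ◃-preserves P F as PF rest x

-- The traces

lapReads : (v₀ v₁ v₂ v₃ n : ℕ) → List ℕ
lapReads v₀ v₁ v₂ v₃ zero    = []
lapReads v₀ v₁ v₂ v₃ (suc n) =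
  v₀ ∷ v₁ ∷ v₂ ∷ v₃ ∷ lapReads (suc v₀) (suc v₁) (suc v₂) (suc v₃) n

lapReads-cong : ∀ {v₀ v₁ v₂ v₃ w₀ w₁ w₂ w₃} n → v₀ ≡ w₀ → v₁ ≡ w₁ → v₂ ≡ w₂ → v₃ ≡ w₃ →
                lapReads v₀ v₁ v₂ v₃ n ≡ lapReads w₀ w₁ w₂ w₃ n
lapReads-cong n refl refl refl refl = refl

LapBounds : (K n v₀ v₁ v₂ v₃ : ℕ) → Set
LapBounds K n v₀ v₁ v₂ v₃ = v₀ + n ≤ K × v₁ + n ≤ K × v₂ + n ≤ K × v₃ + n ≤ K

halfTrace : (K a b : ℕ) → List ℕ
halfTrace K a b =
  lapReads 0 0 0 0 K ++ K ∷ lapReads (suc a) 0 0 0 (suc b) ++ K ∷ lapReads (2 + a) a (suc a) 0 b ++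
  K ∷ K ∷ suc b ∷ K ∷ []

periodTrace : (K i m : ℕ) → List ℕ
periodTrace K i m = halfTrace K i m ++ halfTrace K m i

pair∈periodTrace : ∀ K i m → K ∷ suc i ∷ [] IsFactorOf periodTrace K i m
pair∈periodTrace K i m = _ , _ , ++-assoc (lapReads 0 0 0 0 K) _ (halfTrace K m i)

half-length : ∀ K b → 4 * K + (1 + (4 * suc b + (1 + (4 * b + 4)))) ≡ 4 * K + 8 * b + 10
half-length = solve-∀

period-length : ∀ k i m → suc i + suc m ≡ 2 * k →
                (4 * (2 * k) + 8 * m + 10) + (4 * (2 * k) + 8 * i + 10) ≡ 32 * k + 4
period-length k i m i+m+2≡2k = begin
  (4 * (2 * k) + 8 * m + 10) + (4 * (2 * k) + 8 * i + 10)  ≡⟨ regroup k i m ⟩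
  8 * (2 * k) + 8 * (suc i + suc m) + 4                   ≡⟨ cong (λ n → 8 * (2 * k) + 8 * n + 4)
                                                                   i+m+2≡2k ⟩
  8 * (2 * k) + 8 * (2 * k) + 4                           ≡⟨ double k ⟩
  32 * k + 4                                              ∎
  where
  open ≡-Reasoning
  regroup : ∀ k i m → (4 * (2 * k) + 8 * m + 10) + (4 * (2 * k) + 8 * i + 10) ≡
                      8 * (2 * k) + 8 * (suc i + suc m) + 4
  regroup = solve-∀
  double : ∀ k → 8 * (2 * k) + 8 * (2 * k) + 4 ≡ 32 * k + 4
  double = solve-∀

laps₁-fit : ∀ K → LapBounds K K 0 0 0 0
laps₁-fit K = ℕ.≤-refl , ℕ.≤-refl , ℕ.≤-refl , ℕ.≤-refl

module _ {K a b : ℕ} (a+b+2≡K : suc a + suc b ≡ K) where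

  1+b<K : suc b < K
  1+b<K = subst (suc b <_) a+b+2≡K (ℕ.s≤s (ℕ.m≤n+m (suc b) a))

  2+a+b≡K : 2 + a + b ≡ K
  2+a+b≡K = trans (cong suc (sym (ℕ.+-suc a b))) a+b+2≡K

  laps₂-fit : LapBounds K (suc b) (suc a) 0 0 0
  laps₂-fit = ℕ.≤-reflexive a+b+2≡K , 1+b≤K , 1+b≤K , 1+b≤K
    where
    1+b≤K : suc b ≤ K
    1+b≤K = ℕ.<⇒≤ 1+b<K

  laps₃-fit : LapBounds K b (2 + a) a (suc a) 0
  laps₃-fit = ℕ.≤-reflexive 2+a+b≡K , below (ℕ.m≤n+m (a + b) 2) ,
              below (ℕ.m≤n+m (suc a + b) 1) , below (ℕ.m≤n+m b (2 + a))
    where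
    below : ∀ {n} → n ≤ 2 + a + b → n ≤ K
    below n≤ = subst (_ ≤_) 2+a+b≡K n≤

module Avoidance (K β : ℕ) (β≢K : β ≢ K) where

  K≢β : K ≢ β
  K≢β = β≢K ∘ sym

  Avoids : ℕ → List ℕ → Set
  Avoids p []       = ⊤
  Avoids p (x ∷ xs) = (p ≡ K → x ≢ β) × Avoids x xs

  ¬avoids-pair : ∀ p as bs → ¬ Avoids p (as ++ K ∷ β ∷ bs)
  ¬avoids-pair p []       bs (_ , β-after-K , _) = β-after-K refl refl
  ¬avoids-pair p (x ∷ as) bs (_ , rest)          = ¬avoids-pair x as bs rest

  avoids⇒¬factor : ∀ {p zs} → Avoids p zs → ¬ K ∷ β ∷ [] IsFactorOf zs
  avoids⇒¬factor {p} av (as , bs , refl) = ¬avoids-pair p as bs av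

  ¬conjugate : ∀ {xs ys} → K ∷ β ∷ [] IsFactorOf xs → Avoids 0 (ys ++ ys) →
               ¬ CyclicConj xs ys × ¬ CyclicConj ys xs
  ¬conjugate pair av =
    (λ conj → avoids⇒¬factor av (factor-trans pair (proj₁ (CyclicConj⇒factors conj)))) ,
    (λ conj → avoids⇒¬factor av (factor-trans pair (proj₂ (CyclicConj⇒factors conj))))

  avoids-laps : ∀ {p v₀ v₁ v₂ v₃} n {rest} → (p ≡ K → v₀ ≢ β) →
                LapBounds K n v₀ v₁ v₂ v₃ → Avoids K rest →
                Avoids p (lapReads v₀ v₁ v₂ v₃ n ++ K ∷ rest)
  avoids-laps zero    _     _                   av = (λ _ → K≢β) , av
  avoids-laps (suc n) first (f₀ , f₁ , f₂ , f₃) av =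
    first , below f₀ , below f₁ , below f₂ ,
    avoids-laps n (below f₃) (next f₀ , next f₁ , next f₂ , next f₃) av
    where
    below : ∀ {v w} → v + suc n ≤ K → v ≡ K → w ≢ β
    below {v} fits v≡K = contradiction v≡K (ℕ.<⇒≢ (ℕ.<-≤-trans (ℕ.m<m+n v ℕ.z<s) fits))
    next : ∀ {v} → v + suc n ≤ K → suc v + n ≤ K
    next {v} fits = subst (_≤ K) (ℕ.+-suc v n) fits

  avoids-laps++ : ∀ {p v₀ v₁ v₂ v₃} n {ys rest} → (p ≡ K → v₀ ≢ β) →
                  LapBounds K n v₀ v₁ v₂ v₃ → Avoids K (ys ++ rest) →
                  Avoids p ((lapReads v₀ v₁ v₂ v₃ n ++ K ∷ ys) ++ rest)
  avoids-laps++ {p} {v₀} {v₁} {v₂} {v₃} n {ys} {rest} first fits av =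
    subst (Avoids p) (sym (++-assoc (lapReads v₀ v₁ v₂ v₃ n) (K ∷ ys) rest))
      (avoids-laps n first fits av)

  avoids-halfTrace : ∀ {a b} → suc a + suc b ≡ K →
                     0 ≢ β → suc a ≢ β → 2 + a ≢ β → suc b ≢ β →
                     ∀ {p rest} → Avoids K rest → Avoids p (halfTrace K a b ++ rest)
  avoids-halfTrace {a} {b} a+b+2≡K 0≢β 1+a≢β 2+a≢β 1+b≢β av =
    avoids-laps++ K (λ _ → 0≢β) (laps₁-fit K) (
    avoids-laps++ (suc b) (λ _ → 1+a≢β) (laps₂-fit a+b+2≡K) (
    avoids-laps++ b (λ _ → 2+a≢β) (laps₃-fit a+b+2≡K)
      ((λ _ → K≢β) , (λ _ → 1+b≢β) , (λ _ → K≢β) , av)))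

  avoids-periodTrace² : ∀ {i m} → suc i + suc m ≡ K →
                        0 ≢ β → suc i ≢ β → 2 + i ≢ β → suc m ≢ β → 2 + m ≢ β →
                        Avoids 0 (periodTrace K i m ++ periodTrace K i m)
  avoids-periodTrace² {i} {m} i+m+2≡K 0≢β 1+i≢β 2+i≢β 1+m≢β 2+m≢β =
    subst (Avoids 0) (sym (++-assoc (halfTrace K i m) (halfTrace K m i) (periodTrace K i m)))
      (period (subst (λ l → Avoids K (halfTrace K i m ++ l)) (++-identityʳ (halfTrace K m i))
                 (period tt)))
    where
    m+i+2≡K : suc m + suc i ≡ K
    m+i+2≡K = trans (ℕ.+-comm (suc m) (suc i)) i+m+2≡K
    period : ∀ {p rest} → Avoids K rest → Avoids p (halfTrace K i m ++ halfTrace K m i ++ rest)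
    period av = avoids-halfTrace i+m+2≡K 0≢β 1+i≢β 2+i≢β 1+m≢β
                  (avoids-halfTrace m+i+2≡K 0≢β 1+m≢β 2+m≢β 1+i≢β av)

-- Simulating the ant

module Simulation (k : ℕ) where
  open Ant (antWord k)

  K : ℕ
  K = 2 * k

  iter-+ : ∀ n m c → iter (n + m) c ≡ iter m (iter n c)
  iter-+ zero    m c = refl
  iter-+ (suc n) m c = iter-+ n m (step c)

  trace-+ : ∀ n m c → trace (n + m) c ≡ trace n c ++ trace m (iter n c)
  trace-+ zero    m c = refl
  trace-+ (suc n) m c = cong (_ ∷_) (trace-+ n m (step c))

  always-+ : ∀ (P : Pos → Set) n {m} c → (∀ t → t < n → P (pos (iter t c))) →
             (∀ t → t < m → P (pos (iter t (iter n c)))) → ∀ t → t < n + m → P (pos (iter t c))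
  always-+ P zero    c _      later t       t<m           = later t t<m
  always-+ P (suc n) c before later zero    _             = before zero ℕ.z<s
  always-+ P (suc n) c before later (suc t) (ℕ.s≤s t<n+m) =
    always-+ P n (step c) (λ t t<n → before (suc t) (ℕ.s≤s t<n)) later t t<n+m

  -- The picture is tracked as an ℕ-valued function in coordinates relative to an origin o, so
  -- that one proof of a half period serves for every origin.
  record Represents (o : Pos) (c : Config) (F : Pos → ℕ) (p : Pos) (d : Dir) : Set where
    field
      values : ∀ x → toℕ (pic c (o ⊕ x)) ≡ F x
      at     : pos c ≡ o ⊕ p
      facing : dir c ≡ d
  open Represents

  Represents-cast : ∀ {o c F G p q d e} → (∀ x → F x ≡ G x) → p ≡ q → d ≡ e →
                    Represents o c F p d → Represents o c G q e
  Represents-cast F≗G refl refl rep = record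
    { values = λ x → trans (values rep x) (F≗G x) ; at = at rep ; facing = facing rep }

  rebase : ∀ {o c F p d} v → Represents o c F (v ⊕ p) d → Represents (o ⊕ v) c (F ∘ (v ⊕_)) p d
  rebase {o} {c} {p = p} v rep = record
    { values = λ x → trans (cong (toℕ ∘ pic c) (⊕-assoc o v x)) (values rep (v ⊕ x))
    ; at     = trans (at rep) (sym (⊕-assoc o v p))
    ; facing = facing rep
    }

  record Run (Inside : Pos → Set) (o : Pos) (n : ℕ) (c : Config) (tr : List ℕ)
             (G : Pos → ℕ) (q : Pos) (e : Dir) : Set where
    field
      ends  : Represents o (iter n c) G q e
      reads : map toℕ (trace n c) ≡ tr
      stays : ∀ t → t < n → Inside (pos (iter t c))
  open Run

  Run-++ : ∀ {Inside o o′ n m c tr tr′ G q e H r f} → Run Inside o n c tr G q e →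
           Run Inside o′ m (iter n c) tr′ H r f → Run Inside o′ (n + m) c (tr ++ tr′) H r f
  Run-++ {Inside} {n = n} {m} {c} run run′ = record
    { ends  = subst (λ c′ → Represents _ c′ _ _ _) (sym (iter-+ n m c)) (ends run′)
    ; reads = trans (cong (map toℕ) (trace-+ n m c))
                (trans (map-++ toℕ (trace n c) (trace m (iter n c)))
                  (cong₂ _++_ (reads run) (reads run′)))
    ; stays = always-+ Inside n c (stays run) (stays run′)
    }

  Run-weaken : ∀ {Inside Inside′ o n c tr G q e} → (∀ {x} → Inside x → Inside′ x) →
               Run Inside o n c tr G q e → Run Inside′ o n c tr G q e
  Run-weaken ⊆ run = record
    { ends = ends run ; reads = reads run ; stays = λ t t<n → ⊆ (stays run t t<n) }

  update-values : ∀ {C : Pos → Sym} {F o p a v} →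
                  (∀ x → toℕ (C (o ⊕ x)) ≡ F x) → toℕ a ≡ v →
                  ∀ x → toℕ (update C (o ⊕ p) a (o ⊕ x)) ≡ (F [ p ≔ v ]) x
  update-values {o = o} {p} C≈F a≈v x with (o ⊕ x) ≟ᴾ (o ⊕ p) | x ≟ᴾ p
  ... | yes _  | yes _    = a≈v
  ... | no  _  | no  _    = C≈F x
  ... | yes eq | no  x≢p  = contradiction (⊕-cancelˡ o eq) x≢p
  ... | no  ne | yes refl = contradiction refl ne

  module Relative (o : Pos) (S : List Pos) where

    Runs : ℕ → List ℕ → (Pos → ℕ) → Pos → Dir → (Pos → ℕ) → Pos → Dir → Set
    Runs n tr F p d G q e = ∀ {c} → Represents o c F p d → Run (_∈ map (o ⊕_) S) o n c tr G q e

    infixr 4 _⨾_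
    _⨾_ : ∀ {n m tr tr′ F p d G q e H r f} → Runs n tr F p d G q e → Runs m tr′ G q e H r f →
          Runs (n + m) (tr ++ tr′) F p d H r f
    (first ⨾ then) rep = Run-++ (first rep) (then (ends (first rep)))

    Runs-length : ∀ {n n′ tr F p d G q e} → n ≡ n′ →
                  Runs n tr F p d G q e → Runs n′ tr F p d G q e
    Runs-length refl runs = runs

    Runs-reads : ∀ {n tr tr′ F p d G q e} → tr ≡ tr′ →
                 Runs n tr F p d G q e → Runs n tr′ F p d G q e
    Runs-reads refl runs = runs

    Runs-ends : ∀ {n tr F p d G G′ q q′ e e′} → (∀ x → G x ≡ G′ x) → q ≡ q′ → e ≡ e′ →
                Runs n tr F p d G q e → Runs n tr F p d G′ q′ e′
    Runs-ends G≗G′ q≡q′ e≡e′ runs rep = record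
      { ends  = Represents-cast G≗G′ q≡q′ e≡e′ (ends (runs rep))
      ; reads = reads (runs rep)
      ; stays = stays (runs rep)
      }

    idle : ∀ {F G p d} → (∀ x → F x ≡ G x) → Runs 0 [] F p d G p d
    idle F≗G rep = record { ends = Represents-cast F≗G refl refl rep ; reads = refl ; stays = λ _ () }

    step-run : ∀ {c F p d} (rep : Represents o c F p d) → p ∈ S →
               ∀ {v t} → toℕ (inc (pic c (pos c))) ≡ v → lookup (antWord k) (pic c (pos c)) ≡ t →
               Run (_∈ map (o ⊕_) S) o 1 c (F p ∷ []) (F [ p ≔ v ]) (p ⊕ vec (turn t d)) (turn t d)
    step-run {config C _ _} {F} {p} record { values = C≈F ; at = refl ; facing = refl } p∈S refl refl =
      record
      { ends  = record
        { values = update-values {o = o} {p} C≈F refl ; at = ⊕-assoc o p _ ; facing = refl }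
      ; reads = cong (_∷ []) (C≈F p)
      ; stays = now {P = _∈ map (o ⊕_) S} (∈-map⁺ (o ⊕_) p∈S)
      }
      where
      now : ∀ {P : Pos → Set} {c} → P (pos c) → ∀ t → t < 1 → P (pos (iter t c))
      now Pc zero    _             = Pc
      now Pc (suc t) (ℕ.s≤s ())

    read : ∀ {c F p d} → Represents o c F p d → toℕ (pic c (pos c)) ≡ F p
    read {c} {p = p} rep = trans (cong (toℕ ∘ pic c) (at rep)) (values rep p)

    stepL : ∀ {F p d} → F p < K → {True (p ∈? S)} →
            Runs 1 (F p ∷ []) F p d (F [ p ≔ suc (F p) ]) (p ⊕ vec (ccw d)) (ccw d)
    stepL Fp<K {p∈S} {c} rep = step-run rep (toWitness p∈S)
      (trans (toℕ-inc-< (antWord k) _ s<K) (cong suc (read rep)))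
      (lookup-replicate∷ʳ-< K L R _ s<K)
      where
      s<K : toℕ (pic c (pos c)) < K
      s<K = subst (_< K) (sym (read rep)) Fp<K

    stepR : ∀ {F p d} → F p ≡ K → {True (p ∈? S)} →
            Runs 1 (K ∷ []) F p d (F [ p ≔ 0 ]) (p ⊕ vec (cw d)) (cw d)
    stepR {F} {p} {d} Fp≡K {p∈S} = Runs-reads (cong (_∷ []) Fp≡K) turnRight
      where
      turnRight : Runs 1 (F p ∷ []) F p d (F [ p ≔ 0 ]) (p ⊕ vec (cw d)) (cw d)
      turnRight {c} rep = step-run rep (toWitness p∈S)
        (toℕ-inc-≡ (antWord k) _ s≡K)
        (lookup-replicate∷ʳ-≡ K L R _ s≡K)
        where
        s≡K : toℕ (pic c (pos c)) ≡ K
        s≡K = trans (read rep) Fp≡K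

    raising-step : ∀ {T F p d} → p ∉ T → F p < K → {True (p ∈? S)} →
                   Runs 1 (F p ∷ []) (raise T 1 F) p d (raise (p ∷ T) 1 F) (p ⊕ vec (ccw d)) (ccw d)
    raising-step {F = F} p∉T Fp<K {p∈S} =
      Runs-reads (cong (_∷ []) (raise-∉ 1 F p∉T))
        (Runs-ends (raise-∷ F p∉T) refl refl
          (stepL (subst (_< K) (sym (raise-∉ 1 F p∉T)) Fp<K) {p∈S}))

    -- The side conditions on the square are implicit so that they are decided by computation
    -- wherever the square is given concretely.
    module Laps (p₀ : Pos) (d₀ : Dir) where
      open Square p₀ d₀

      module _ {closes : True ((p₃ ⊕ vec d₀) ≟ᴾ p₀)} {distinct : True (unique? cells)}
               {inside : True (all? (_∈? S) cells)} where

        lap : ∀ {F} → F p₀ < K → F p₁ < K → F p₂ < K → F p₃ < K →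
              Runs 4 (F p₀ ∷ F p₁ ∷ F p₂ ∷ F p₃ ∷ []) F p₀ d₀ (raise cells 1 F) p₀ d₀
        lap f₀ f₁ f₂ f₃ with toWitness distinct | toWitness inside
        ... | p₃∉ ∷ p₂∉ ∷ p₁∉ ∷ _ | p₃∈ ∷ p₂∈ ∷ p₁∈ ∷ p₀∈ ∷ [] =
          Runs-ends (λ _ → refl) around (ccw⁴ d₀)
            (  raising-step (λ ())          f₀ {fromWitness p₀∈}
             ⨾ raising-step (All¬⇒¬Any p₁∉) f₁ {fromWitness p₁∈}
             ⨾ raising-step (All¬⇒¬Any p₂∉) f₂ {fromWitness p₂∈}
             ⨾ raising-step (All¬⇒¬Any p₃∉) f₃ {fromWitness p₃∈})
          where
          around : p₃ ⊕ vec (ccw (ccw (ccw (ccw d₀)))) ≡ p₀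
          around = trans (cong (λ d → p₃ ⊕ vec d) (ccw⁴ d₀)) (toWitness closes)

        laps : ∀ n {F} → LapBounds K n (F p₀) (F p₁) (F p₂) (F p₃) →
               Runs (4 * n) (lapReads (F p₀) (F p₁) (F p₂) (F p₃) n) F p₀ d₀ (raise cells n F) p₀ d₀
        laps zero    {F} _                   = idle (λ x → sym (raise-zero {cells} F x))
        laps (suc n) {F} (f₀ , f₁ , f₂ , f₃) =
          Runs-length (sym (ℕ.*-suc 4 n)) (Runs-reads reads≡ (Runs-ends (raise-+ {cells} n 1 F) refl refl
            (lap (below f₀) (below f₁) (below f₂) (below f₃) ⨾
             laps n (next p₀∈ f₀ , next p₁∈ f₁ , next p₂∈ f₂ , next p₃∈ f₃))))
          where
          p₀∈ : p₀ ∈ cells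
          p₀∈ = there (there (there (here refl)))
          p₁∈ : p₁ ∈ cells
          p₁∈ = there (there (here refl))
          p₂∈ : p₂ ∈ cells
          p₂∈ = there (here refl)
          p₃∈ : p₃ ∈ cells
          p₃∈ = here refl
          below : ∀ {x} → F x + suc n ≤ K → F x < K
          below {x} fits = ℕ.<-≤-trans (ℕ.m<m+n (F x) ℕ.z<s) fits
          next : ∀ {x} → x ∈ cells → F x + suc n ≤ K → raise cells 1 F x + n ≤ K
          next {x} x∈ fits =
            subst (_≤ K) (sym (trans (cong (_+ n) (raise-∈ 1 F x∈)) (ℕ.+-assoc (F x) 1 n))) fits
          raised : ∀ {x} → x ∈ cells → raise cells 1 F x ≡ suc (F x)
          raised {x} x∈ = trans (raise-∈ 1 F x∈) (ℕ.+-comm (F x) 1)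
          reads≡ : F p₀ ∷ F p₁ ∷ F p₂ ∷ F p₃ ∷ lapReads (raise cells 1 F p₀) (raise cells 1 F p₁)
                                                        (raise cells 1 F p₂) (raise cells 1 F p₃) n
                   ≡ lapReads (F p₀) (F p₁) (F p₂) (F p₃) (suc n)
          reads≡ = cong (λ l → F p₀ ∷ F p₁ ∷ F p₂ ∷ F p₃ ∷ l)
                        (lapReads-cong n (raised p₀∈) (raised p₁∈) (raised p₂∈) (raised p₃∈))

  module HalfPeriod (a b : ℕ) (a+b+2≡K : suc a + suc b ≡ K) where

    seeds : List (Pos × ℕ)
    seeds = ((-1 , -1) , 2 + a) ∷ ((0 , -1) , suc a) ∷ ((-1 , -2) , a) ∷ ((0 , -2) , suc a) ∷
            ((0 , 0) , 0) ∷ ((0 , 1) , 0) ∷ ((-1 , 1) , 0) ∷ ((-1 , 0) , 0) ∷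
            ((1 , -1) , 0) ∷ ((1 , 0) , 0) ∷ []

    afterHalf : (Pos → ℕ) → Pos → ℕ
    afterHalf F = G [ (0 , 0) ≔ 2 + b ] [ (0 , 1) ≔ 0 ]
      where
      G₁ G₂ G : Pos → ℕ
      G₁ = raise (Square.cells (0 , 0) east) K (F ◃ seeds) [ (0 , 0) ≔ 0 ]
      G₂ = raise (Square.cells (0 , -1) south) (suc b) G₁ [ (0 , -1) ≔ 0 ]
      G  = raise (Square.cells (-1 , -1) west) b G₂ [ (-1 , -1) ≔ 0 ] [ (-1 , 0) ≔ 0 ]

    half : ∀ o F → Relative.Runs o halfCells (4 * K + 8 * b + 10) (halfTrace K a b)
                                (F ◃ seeds) (0 , 0) east (afterHalf F) (1 , 1) east
    half o F = Runs-length (half-length K b) (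
        Laps.laps (0 , 0) east K (laps₁-fit K)
      ⨾ stepR refl
      ⨾ Laps.laps (0 , -1) south (suc b) (laps₂-fit a+b+2≡K)
      ⨾ stepR a+b+2≡K
      ⨾ Laps.laps (-1 , -1) west b (laps₃-fit a+b+2≡K)
      ⨾ stepR (2+a+b≡K a+b+2≡K)
      ⨾ stepR refl
      ⨾ stepL (1+b<K a+b+2≡K)
      ⨾ stepR refl)
      where open Relative o halfCells

-- The highways

module Construction (k i m : ℕ) (i+m+2≡2k : suc i + suc m ≡ 2 * k) where
  open Simulation k
  open Ant (antWord k) using (Sym; Config; config; iter; pic; pos; IsHighway)
  open Represents
  open Run

  support : List Pos
  support = map ((0 , 0) ⊕_) halfCells ++ map ((1 , 1) ⊕_) halfCells

  δ : Pos
  δ = (2 , 2)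

  module First  = HalfPeriod i m i+m+2≡2k
  module Second = HalfPeriod m i (trans (ℕ.+-comm (suc m) (suc i)) i+m+2≡2k)

  blank : Pos → ℕ
  blank _ = 0

  start : Pos → ℕ
  start = blank ◃ First.seeds

  start-< : ∀ x → start x < suc K
  start-< = ◃-preserves (_< suc K) blank First.seeds (λ _ → ℕ.z<s)
    (fits ℕ.≤-refl ∷ fits (ℕ.n≤1+n _) ∷ fits (ℕ.m≤n+m i 2) ∷ fits (ℕ.n≤1+n _) ∷
     ℕ.z<s ∷ ℕ.z<s ∷ ℕ.z<s ∷ ℕ.z<s ∷ ℕ.z<s ∷ ℕ.z<s ∷ [])
    where
    fits : ∀ {v} → v ≤ 2 + i → v < suc K
    fits v≤ = ℕ.s≤s (ℕ.≤-trans v≤ (ℕ.≤-trans (ℕ.m≤m+n (2 + i) m)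
                                              (ℕ.≤-reflexive (2+a+b≡K i+m+2≡2k))))

  P₀ : Pos → Sym
  P₀ x = Fin.fromℕ< (start-< x)

  c₀ : Config
  c₀ = config P₀ (0 , 0) east

  initially : Represents (0 , 0) c₀ start (0 , 0) east
  initially = record
    { values = λ x → trans (Fin.toℕ-fromℕ< _) (cong start (⊕-identityˡ x))
    ; at     = refl
    ; facing = refl
    }

  middle : Pos → ℕ
  middle = First.afterHalf blank ∘ ((1 , 1) ⊕_)

  middle-seeded : ∀ x → (middle ◃ Second.seeds) x ≡ middle x
  middle-seeded = ◃-self middle Second.seeds
    (refl ∷ refl ∷ refl ∷ refl ∷ refl ∷ refl ∷ refl ∷ refl ∷ refl ∷ refl ∷ [])

  period : Run (_∈ support) (1 , 1) (32 * k + 4) c₀ (periodTrace K i m)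
               (Second.afterHalf middle) (1 , 1) east
  period = subst (λ n → Run (_∈ support) (1 , 1) n c₀ (periodTrace K i m)
                            (Second.afterHalf middle) (1 , 1) east)
    (period-length k i m i+m+2≡2k)
    (Run-++ firstHalf (Run-weaken (∈-++⁺ʳ (map ((0 , 0) ⊕_) halfCells)) (Second.half (1 , 1) middle
      (Represents-cast (λ x → sym (middle-seeded x)) refl refl (rebase (1 , 1) (ends firstHalf))))))
    where
    firstHalf : Run (_∈ support) (0 , 0) (4 * K + 8 * m + 10) c₀ (halfTrace K i m)
                    (First.afterHalf blank) (1 , 1) east
    firstHalf = Run-weaken ∈-++⁺ˡ (First.half (0 , 0) blank initially)

  final : Pos → ℕ
  final = Second.afterHalf middle ∘ ((1 , 1) ⊕_)

  end : Config
  end = iter (32 * k + 4) c₀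

  finally : ∀ x → toℕ (pic end (x ⊕ δ)) ≡ final x
  finally x = trans (cong (toℕ ∘ pic end) (⊕-comm x δ))
                    (values (rebase {p = 0 , 0} (1 , 1) (ends period)) x)

  recurring : List Pos
  recurring = (-1 , 0) ∷ (-1 , -1) ∷ (0 , -1) ∷ (-1 , -2) ∷ (0 , -2) ∷ []

  shifts-into-recurring : All (λ x → x ⊕ δ ∈ support → x ∈ recurring) support
  shifts-into-recurring =
    from-yes (all? (λ x → (x ⊕ δ ∈? support) →-dec (x ∈? recurring)) support)

  start≡final-on-recurring : All (λ x → start x ≡ final x) recurring
  start≡final-on-recurring = refl ∷ refl ∷ refl ∷ refl ∷ refl ∷ []

  start-vanishes : All (λ x → x ⊕ δ ∈ support ⊎ start x ≡ 0) support
  start-vanishes = from-yes (all? (λ x → (x ⊕ δ ∈? support) ⊎-dec (start x ℕ.≟ 0)) support)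

  isHighway : IsHighway (32 * k + 4) δ support P₀ (0 , 0) east
  isHighway = record
    { start∈S  = here refl
    ; staysIn  = stays period
    ; endPos   = at (ends period)
    ; endDir   = facing (ends period)
    ; shiftIn  = λ x x∈S xδ∈S → Fin.toℕ-injective (begin
        toℕ (P₀ x)             ≡⟨ Fin.toℕ-fromℕ< _ ⟩
        start x                ≡⟨ All.lookup start≡final-on-recurring
                                    (All.lookup shifts-into-recurring x∈S xδ∈S) ⟩
        final x                ≡⟨ finally x ⟨
        toℕ (pic end (x ⊕ δ))  ∎)
    ; shiftOut = λ x x∈S xδ∉S → Fin.toℕ-injective
        (trans (Fin.toℕ-fromℕ< _)
               ([ flip contradiction xδ∉S , id ]′ (All.lookup start-vanishes x∈S)))
    }
    where open ≡-Reasoning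

  harmonic : HarmonicHighway k
  harmonic = δ , (inj₁ refl , inj₁ refl) , record
    { support = support ; values = P₀ ; start = (0 , 0) ; heading = east ; isHighway = isHighway }

  harmonic-trace : map toℕ (hhTrace k harmonic) ≡ periodTrace K i m
  harmonic-trace = reads period

module Family (k′ : ℕ) where

  k : ℕ
  k = 2 + k′

  -- For i ≤ k′ this is 2k − 2 − i, written so that partner i ≥ k′ + 2 is evident.
  partner : ℕ → ℕ
  partner i = k′ + (2 + (k′ ∸ i))

  partner-sum : ∀ {i} → i ≤ k′ → suc i + suc (partner i) ≡ 2 * k
  partner-sum {i} i≤k′ = begin
    suc i + suc (k′ + (2 + (k′ ∸ i)))  ≡⟨ regroup i k′ (k′ ∸ i) ⟩
    4 + k′ + (i + (k′ ∸ i))            ≡⟨ cong (4 + k′ +_) (ℕ.m+[n∸m]≡n i≤k′) ⟩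
    4 + k′ + k′                        ≡⟨ double k′ ⟩
    2 * k                              ∎
    where
    open ≡-Reasoning
    regroup : ∀ i k′ d → suc i + suc (k′ + (2 + d)) ≡ 4 + k′ + (i + d)
    regroup = solve-∀
    double : ∀ k′ → 4 + k′ + k′ ≡ 2 * (2 + k′)
    double = solve-∀

  module Of (a : Fin (suc k′)) =
    Construction k (toℕ a) (partner (toℕ a)) (partner-sum (Fin.toℕ≤pred[n] a))

  highway : Fin (suc k′) → HarmonicHighway k
  highway = Of.harmonic

  distinct-< : ∀ a b → toℕ a < toℕ b →
               Distinct k (highway a) (highway b) × Distinct k (highway b) (highway a)
  distinct-< a b i<j =
    (λ conj → proj₁ separated (CyclicConj-map toℕ conj)) ,
    (λ conj → proj₂ separated (CyclicConj-map toℕ conj))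
    where
    i n : ℕ
    i = toℕ a
    n = partner (toℕ b)
    i<n : i < n
    i<n = ℕ.<-≤-trans i<j (ℕ.≤-trans (Fin.toℕ≤pred[n] b) (ℕ.m≤m+n k′ _))
    1+i<2k : suc i < 2 * k
    1+i<2k = subst (suc i <_) (partner-sum (Fin.toℕ≤pred[n] a)) (ℕ.m<m+n (suc i) ℕ.z<s)
    above : ∀ {x} → suc i < x → x ≢ suc i
    above i<x x≡i = ℕ.<-irrefl (sym x≡i) i<x
    open Avoidance (2 * k) (suc i) (ℕ.<⇒≢ 1+i<2k)
    reads : Fin (suc k′) → List ℕ
    reads c = map toℕ (hhTrace k (highway c))
    separated : ¬ CyclicConj (reads a) (reads b) × ¬ CyclicConj (reads b) (reads a)
    separated = ¬conjugate
      (subst (2 * k ∷ suc i ∷ [] IsFactorOf_) (sym (Of.harmonic-trace a))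
        (pair∈periodTrace (2 * k) i (partner i)))
      (subst (λ u → Avoids 0 (u ++ u)) (sym (Of.harmonic-trace b))
        (avoids-periodTrace² (partner-sum (Fin.toℕ≤pred[n] b)) (λ ())
          (above (ℕ.s≤s i<j)) (above (ℕ.s≤s (ℕ.m<n⇒m<1+n i<j)))
          (above (ℕ.s≤s i<n)) (above (ℕ.s≤s (ℕ.m<n⇒m<1+n i<n)))))

  distinct : ∀ a b → a ≢ b → Distinct k (highway a) (highway b)
  distinct a b a≢b with ℕ.<-cmp (toℕ a) (toℕ b)
  ... | tri< i<j _ _ = proj₁ (distinct-< a b i<j)
  ... | tri≈ _ i≡j _ = contradiction (Fin.toℕ-injective i≡j) a≢b
  ... | tri> _ _ j<i = proj₂ (distinct-< b a j<i)

mainTheorem3 : (k : ℕ) → 1 < k →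
    Σ (Vec (HarmonicHighway k) (k ∸ 1)) λ hs →
      (i j : Fin (k ∸ 1)) → i ≢ j → Distinct k (lookup hs i) (lookup hs j)
mainTheorem3 (suc zero)       (ℕ.s≤s ())
mainTheorem3 (suc (suc k′)) _ = tabulate highway , λ a b a≢b →
  subst₂ (Distinct k) (sym (lookup∘tabulate highway a)) (sym (lookup∘tabulate highway b))
    (distinct a b a≢b)
  where open Family k′
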